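{- Let $q=p^n$ where $p$ is a prime with $p\equiv 3\pmod 4$ and $n$ is odd, and $V=\mathbb{F}_q^3$. Let $I=\mathbb{F}_q\cup\{\infty,\bullet\}$, $O_i=\{(s(x^2/2+i),sx,s)^T\mid x\in\mathbb{F}_q,s\in\mathbb{F}_q^{*2}\}$ for $i\in\mathbb{F}_q$, $O_\infty=\{(x,s,0)^T\mid x\in\mathbb{F}_q,s\in\mathbb{F}_q^{*2}\}$, $O_\bullet=\{(s,0,0)^T\mid s\in\mathbb{F}_q^{*2}\}$ ($\mathbb{F}_q^{*2}$ the nonzero squares). Let $\varepsilon:I\to\{\pm1\}$ be such that $D:=\bigcup_{i\in I}\varepsilon(i)O_i$ is a skew Hadamard difference set in $V$, and let $J=\{i\in\mathbb{F}_q\mid\varepsilon(i)=1\}$. For $\alpha\in\mathbb{F}_q$ let $\hat\alpha$ be the linear map $(x,y,z)^T\mapsto(x+\alpha z,y,z)^T$, and $U=\{\hat\alpha\mid\alpha\in\mathbb{F}_q\}$. Let $F$ be the group of maps $(x,y,z)^T\mapsto(f(x),f(y),f(z))^T$, $f\in\mathrm{Gal}(\mathbb{F}_q/\mathbb{F}_p)$, and $F_p$ its Sylow $p$-subgroup. Let $Q$ be the setwise stabilizer of $D$ in the group $UF_p$. Then $Q$ consists exactly of the products $\hat\alpha f$ with $\alpha\in\mathbb{F}_q$, $f\in F_p$ such that $f(J)+\alpha=J$.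
   Context: A subset $D$ of a finite group $H$ is a skew Hadamard difference set if every non-identity element is expressible as $d_1d_2^{ -1}$ ($d_1,d_2\in D$) in exactly $\lambda$ ways for a fixed $\lambda$, $H\setminus\{1_H\}=D\cup D^{(-1)}$ and $D\cap D^{(-1)}=\emptyset$. Here $f(J)=\{f(j)\mid j\in J\}$ and $f(J)+\alpha=\{j+\alpha\mid j\in f(J)\}$. -}

module Defs where

open import Level using (0ℓ)
open import Data.Nat using (ℕ; suc)
open import Data.Product using (Σ; ∃; ∃-syntax; _×_; _,_)
open import Data.Sum using (_⊎_)
open import Data.Sign using (Sign)
import Data.Empty
import Data.Nat
open import Data.List using (List; length; filter; map; cartesianProduct; concatMap)
open import Data.List.Membership.Propositional using (_∈_)
open import Data.List.Relation.Unary.Unique.Propositional using (Unique)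
open import Function using (_∘_; id)
open import Function.Bundles using (_⇔_)
open import Relation.Nullary using (¬_; _×-dec_)
open import Relation.Unary using (Pred; Decidable)
open import Relation.Binary.PropositionalEquality using (_≡_; _≗_)
open import Relation.Binary.Definitions using (DecidableEquality)
open import Algebra.Structures using (IsCommutativeRing)

-- A finite field, with propositional equality, a total inverse
-- (convention 0⁻¹ arbitrary), decidable equality, and a duplicate-free
-- complete enumeration of its elements (so |F| = length elems).
record FiniteField : Set₁ where
  infixl 6 _+_
  infixl 7 _*_
  field
    Carrier : Set
    _+_ _*_ : Carrier → Carrier → Carrier
    -_ : Carrier → Carrier
    _⁻¹ : Carrier → Carrier
    0# 1# : Carrier
    isCommutativeRing : IsCommutativeRing _≡_ _+_ _*_ -_ 0# 1#
    0≢1 : ¬ (0# ≡ 1#)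
    inverseʳ : ∀ x → ¬ (x ≡ 0#) → x * (x ⁻¹) ≡ 1#
    _≟_ : DecidableEquality Carrier
    elems : List Carrier
    complete : ∀ x → x ∈ elems
    unique : Unique elems

module _ (F : FiniteField) where
  open FiniteField F

  V : Set
  V = Carrier × Carrier × Carrier

  _+V_ : V → V → V
  (a , b , c) +V (x , y , z) = (a + x , b + y , c + z)

  negV : V → V
  negV (x , y , z) = (- x , - y , - z)

  _-V_ : V → V → V
  u -V v = u +V negV v

  0V : V
  0V = (0# , 0# , 0#)

  _≟V_ : DecidableEquality V
  (a , b , c) ≟V (x , y , z) with a ≟ x | b ≟ y | c ≟ z
  ... | Relation.Nullary.yes Relation.Binary.PropositionalEquality.refl
      | Relation.Nullary.yes Relation.Binary.PropositionalEquality.refl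
      | Relation.Nullary.yes Relation.Binary.PropositionalEquality.refl = Relation.Nullary.yes Relation.Binary.PropositionalEquality.refl
  ... | Relation.Nullary.no ¬p | _ | _ = Relation.Nullary.no λ { Relation.Binary.PropositionalEquality.refl → ¬p Relation.Binary.PropositionalEquality.refl }
  ... | Relation.Nullary.yes _ | Relation.Nullary.no ¬p | _ = Relation.Nullary.no λ { Relation.Binary.PropositionalEquality.refl → ¬p Relation.Binary.PropositionalEquality.refl }
  ... | Relation.Nullary.yes _ | Relation.Nullary.yes _ | Relation.Nullary.no ¬p = Relation.Nullary.no λ { Relation.Binary.PropositionalEquality.refl → ¬p Relation.Binary.PropositionalEquality.refl }

  elemsV : List V
  elemsV = concatMap (λ x → concatMap (λ y → map (λ z → (x , y , z)) elems) elems) elems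

  diffCount : (D : Pred V 0ℓ) → Decidable D → V → ℕ
  diffCount D D? v =
    length (filter (λ { (d₁ , d₂) → D? d₁ ×-dec (D? d₂ ×-dec ((d₁ -V d₂) ≟V v)) })
                   (cartesianProduct elemsV elemsV))

  IsSkewHadamardDS : (D : Pred V 0ℓ) → Decidable D → Set
  IsSkewHadamardDS D D? =
    (∃[ λ' ] ∀ v → ¬ (v ≡ 0V) → diffCount D D? v ≡ λ')
    × (∀ v → ¬ (v ≡ 0V) → D v ⊎ D (negV v))
    × (¬ D 0V)
    × (∀ v → D v → D (negV v) → Data.Empty.⊥)

  NonzeroSquare : Carrier → Set
  NonzeroSquare s = ¬ (s ≡ 0#) × ∃[ t ] s ≡ t * t

  two : Carrier
  two = 1# + 1#

  data Idx : Set where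
    fin : Carrier → Idx
    ∞ : Idx
    • : Idx

  O : Idx → Pred V 0ℓ
  O (fin i) v = ∃[ x ] ∃[ s ] NonzeroSquare s × v ≡ (s * (x * x * two ⁻¹ + i) , s * x , s)
  O ∞ v = ∃[ x ] ∃[ s ] NonzeroSquare s × v ≡ (x , s , 0#)
  O • v = ∃[ s ] NonzeroSquare s × v ≡ (s , 0# , 0#)

  signScale : Sign → V → V
  signScale Sign.+ v = v
  signScale Sign.- v = negV v

  InD : (Idx → Sign) → Pred V 0ℓ
  InD ε v = ∃[ i ] ∃[ w ] O i w × v ≡ signScale (ε i) w

  InJ : (Idx → Sign) → Pred Carrier 0ℓ
  InJ ε i = ε (fin i) ≡ Sign.+

  -- field automorphisms of F_q (= Gal(F_q/F_p), every automorphism fixes F_p)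
  record Aut : Set where
    field
      fun inv : Carrier → Carrier
      inv-l : ∀ x → inv (fun x) ≡ x
      inv-r : ∀ x → fun (inv x) ≡ x
      hom-+ : ∀ x y → fun (x + y) ≡ fun x + fun y
      hom-* : ∀ x y → fun (x * y) ≡ fun x * fun y
      hom-1 : fun 1# ≡ 1#

  iter : ℕ → (Carrier → Carrier) → Carrier → Carrier
  iter ℕ.zero f = id
  iter (suc k) f = f ∘ iter k f

  -- f ∈ F_p (Sylow p-subgroup of the cyclic group Gal(F_q/F_p)):
  -- f has p-power order
  InSylow : ℕ → Aut → Set
  InSylow p f = ∃[ k ] iter (p Data.Nat.^ k) (Aut.fun f) ≗ id

  onV : Aut → V → V
  onV f (x , y , z) = (Aut.fun f x , Aut.fun f y , Aut.fun f z)

  hat : Carrier → V → V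
  hat α (x , y , z) = (x + α * z , y , z)

  InUFp : ℕ → (V → V) → Set
  InUFp p g = ∃[ α ] ∃[ f ] InSylow p f × g ≗ (hat α ∘ onV f)

  Stabilizes : (V → V) → Pred V 0ℓ → Set
  Stabilizes g D = ∀ v → (∃[ w ] D w × g w ≡ v) ⇔ D v

  ShiftedImageEq : Aut → Carrier → Pred Carrier 0ℓ → Set
  ShiftedImageEq f α J = ∀ y → (∃[ j ] J j × y ≡ Aut.fun f j + α) ⇔ J y

-- Skewness alone forces -1 to be a nonsquare: otherwise v and -v lie in the
-- same orbit O_0, so D and -D would meet. Hence 2 ≠ 0, and the signed orbits
-- ±O_i (i ∈ F_q) are pairwise disjoint and disjoint from ±O_∞, ±O_•: the
-- third coordinate of a point of ±O_i is ± a nonzero square, which fixes the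
-- sign, then the scale s, then x, then i. The map α̂ f sends O_i onto
-- O_{f(i)+α} and fixes O_∞ and O_•, so it stabilises D exactly when ε is
-- invariant under i ↦ f(i) + α on F_q, i.e. when f(J) + α = J.
module Submission where

open import Defs
open import Data.Nat using (ℕ; _^_; _%_)
open import Data.Nat.Primality using (Prime)
open import Data.Product using (_×_; ∃-syntax; _,_; proj₁; proj₂)
open import Data.Sign using (Sign)
open import Data.Sum using (_⊎_; inj₁; inj₂)
open import Data.Empty using (⊥; ⊥-elim)
open import Data.List using (length)
open import Function using (_∘_; case_of_)
open import Function.Bundles using (_⇔_; mk⇔; Equivalence)
open import Level using (0ℓ)
open import Relation.Nullary using (¬_)
open import Relation.Unary using (Decidable)
open import Relation.Binary.PropositionalEquality
  using (_≡_; _≗_; refl; sym; trans; cong; cong₂; module ≡-Reasoning)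
open import Algebra.Bundles using (CommutativeRing)
import Algebra.Properties.Ring as RingProperties
import Algebra.Solver.CommutativeMonoid as CommutativeMonoidSolver

module _ (F : FiniteField) where
  open FiniteField F
  open ≡-Reasoning

  private
    commutativeRing : CommutativeRing 0ℓ 0ℓ
    commutativeRing = record { isCommutativeRing = isCommutativeRing }

  open CommutativeRing commutativeRing
    using (ring; *-commutativeMonoid; +-assoc; *-assoc; *-comm; distribˡ;
           +-identityʳ; *-identityʳ; zeroʳ; -‿inverseˡ)
  open RingProperties ring
    using (+-cancelˡ; +-cancelʳ; +-inverseˡ-unique; -0#≈0#; -‿involutive; -‿distribˡ-*;
           -‿distribʳ-*; -‿+-comm; x+x≈x⇒x≈0)

  IsNonsquare : Carrier → Set
  IsNonsquare a = ¬ (∃[ t ] a ≡ t * t)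

  1≢0 : ¬ 1# ≡ 0#
  1≢0 = 0≢1 ∘ sym

  +-neg-cancelʳ : ∀ a b → (a + - b) + b ≡ a
  +-neg-cancelʳ a b = begin
    (a + - b) + b ≡⟨ +-assoc a (- b) b ⟩
    a + (- b + b) ≡⟨ cong (a +_) (-‿inverseˡ b) ⟩
    a + 0#        ≡⟨ +-identityʳ a ⟩
    a             ∎

  *-⁻¹-cancelʳ : ∀ s x → ¬ s ≡ 0# → x * s * s ⁻¹ ≡ x
  *-⁻¹-cancelʳ s x s≢0 = begin
    x * s * s ⁻¹   ≡⟨ *-assoc x s (s ⁻¹) ⟩
    x * (s * s ⁻¹) ≡⟨ cong (x *_) (inverseʳ s s≢0) ⟩
    x * 1#         ≡⟨ *-identityʳ x ⟩
    x              ∎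

  *-almostCancelˡ : ∀ s x y → ¬ s ≡ 0# → s * x ≡ s * y → x ≡ y
  *-almostCancelˡ s x y s≢0 eq = begin
    x            ≡⟨ sym (*-⁻¹-cancelʳ s x s≢0) ⟩
    x * s * s ⁻¹ ≡⟨ cong (_* s ⁻¹) (trans (*-comm x s) (trans eq (*-comm s y))) ⟩
    y * s * s ⁻¹ ≡⟨ *-⁻¹-cancelʳ s y s≢0 ⟩
    y            ∎

  ⁻¹-unique : ∀ a b → ¬ a ≡ 0# → a * b ≡ 1# → b ≡ a ⁻¹
  ⁻¹-unique a b a≢0 ab≡1 = *-almostCancelˡ a b (a ⁻¹) a≢0 (trans ab≡1 (sym (inverseʳ a a≢0)))

  -1-nonsquare⇒two≢0 : IsNonsquare (- 1#) → ¬ two F ≡ 0#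
  -1-nonsquare⇒two≢0 nonsq 2≡0 =
    nonsq (1# , trans (sym (+-inverseˡ-unique 1# 1# 2≡0)) (sym (*-identityʳ 1#)))

  -- -1 = (-s) · s⁻¹ · (s · s⁻¹), a product of squares.
  -1-nonsquare⇒¬nonzeroSquare-neg : IsNonsquare (- 1#) → ∀ {s} →
    NonzeroSquare F s → ¬ NonzeroSquare F (- s)
  -1-nonsquare⇒¬nonzeroSquare-neg nonsq {s} (s≢0 , t , s≡tt) (_ , t' , -s≡t't') =
    nonsq (t' * u * t , -1≡square)
    where
      u = s ⁻¹
      module S = CommutativeMonoidSolver *-commutativeMonoid
      -1≡square : - 1# ≡ (t' * u * t) * (t' * u * t)
      -1≡square = begin
        - 1#                        ≡⟨ cong -_ (sym (inverseʳ s s≢0)) ⟩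
        - (s * u)                   ≡⟨ -‿distribˡ-* s u ⟩
        - s * u                     ≡⟨ cong (- s *_) (sym (*-identityʳ u)) ⟩
        - s * (u * 1#)              ≡⟨ cong (λ z → - s * (u * z)) (sym (inverseʳ s s≢0)) ⟩
        - s * (u * (s * u))         ≡⟨ cong₂ (λ a b → a * (u * (b * u))) -s≡t't' s≡tt ⟩
        t' * t' * (u * (t * t * u)) ≡⟨ S.solve 3 (λ t' u t → (t' S.⊕ t') S.⊕ (u S.⊕ ((t S.⊕ t) S.⊕ u))
                                        S.⊜ ((t' S.⊕ u) S.⊕ t) S.⊕ ((t' S.⊕ u) S.⊕ t)) refl t' u t ⟩
        (t' * u * t) * (t' * u * t) ∎

  module AutProperties (f : Aut F) where
    open Aut f

    fun-0 : fun 0# ≡ 0#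
    fun-0 = x+x≈x⇒x≈0 (fun 0#) (trans (sym (hom-+ 0# 0#)) (cong fun (+-identityʳ 0#)))

    fun-neg : ∀ x → fun (- x) ≡ - fun x
    fun-neg x = +-inverseˡ-unique (fun (- x)) (fun x)
      (trans (sym (hom-+ (- x) x)) (trans (cong fun (-‿inverseˡ x)) fun-0))

    fun-injective : ∀ {a b} → fun a ≡ fun b → a ≡ b
    fun-injective {a} {b} eq = trans (sym (inv-l a)) (trans (cong inv eq) (inv-l b))

    fun-nonzero : ∀ {x} → ¬ x ≡ 0# → ¬ fun x ≡ 0#
    fun-nonzero x≢0 eq = x≢0 (fun-injective (trans eq (sym fun-0)))

    fun-nonzeroSquare : ∀ {s} → NonzeroSquare F s → NonzeroSquare F (fun s)
    fun-nonzeroSquare (s≢0 , t , s≡tt) = fun-nonzero s≢0 , fun t , trans (cong fun s≡tt) (hom-* t t)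

    fun-⁻¹ : ∀ x → ¬ x ≡ 0# → fun (x ⁻¹) ≡ fun x ⁻¹
    fun-⁻¹ x x≢0 = ⁻¹-unique (fun x) (fun (x ⁻¹)) (fun-nonzero x≢0)
      (trans (sym (hom-* x (x ⁻¹))) (trans (cong fun (inverseʳ x x≢0)) hom-1))

    fun-two⁻¹ : ¬ two F ≡ 0# → fun (two F ⁻¹) ≡ two F ⁻¹
    fun-two⁻¹ 2≢0 = trans (fun-⁻¹ (two F) 2≢0) (cong _⁻¹ (trans (hom-+ 1# 1#) (cong₂ _+_ hom-1 hom-1)))

    fun-inv-shift : ∀ α k → fun (inv k + inv (- α)) + α ≡ k
    fun-inv-shift α k = begin
      fun (inv k + inv (- α)) + α         ≡⟨ cong (_+ α) (hom-+ (inv k) (inv (- α))) ⟩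
      (fun (inv k) + fun (inv (- α))) + α ≡⟨ cong₂ (λ a b → (a + b) + α) (inv-r k) (inv-r (- α)) ⟩
      (k + - α) + α                       ≡⟨ +-neg-cancelʳ k α ⟩
      k                                   ∎

  inverseAut : Aut F → Aut F
  inverseAut f = record
    { fun = inv ; inv = fun ; inv-l = inv-r ; inv-r = inv-l
    ; hom-+ = inv-hom hom-+ ; hom-* = inv-hom hom-*
    ; hom-1 = trans (cong inv (sym hom-1)) (inv-l 1#) }
    where
      open Aut f
      inv-hom : ∀ {_∙_} → (∀ x y → fun (x ∙ y) ≡ fun x ∙ fun y) → ∀ x y → inv (x ∙ y) ≡ inv x ∙ inv y
      inv-hom {_∙_} hom x y = begin
        inv (x ∙ y)                   ≡⟨ cong inv (cong₂ _∙_ (sym (inv-r x)) (sym (inv-r y))) ⟩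
        inv (fun (inv x) ∙ fun (inv y)) ≡⟨ cong inv (sym (hom (inv x) (inv y))) ⟩
        inv (fun (inv x ∙ inv y))     ≡⟨ inv-l (inv x ∙ inv y) ⟩
        inv x ∙ inv y                 ∎

  orbitPoint : Carrier → Carrier → Carrier → V F
  orbitPoint k x s = (s * (x * x * two F ⁻¹ + k) , s * x , s)

  third : V F → Carrier
  third (_ , _ , z) = z

  negV-involutive : ∀ v → negV F (negV F v) ≡ v
  negV-involutive (x , y , z) = cong₂ _,_ (-‿involutive x) (cong₂ _,_ (-‿involutive y) (-‿involutive z))

  signScale-cases : ∀ e e' a b → signScale F e a ≡ signScale F e' b →
    (e ≡ e' × a ≡ b) ⊎ a ≡ negV F b
  signScale-cases Sign.+ Sign.+ a b eq = inj₁ (refl , eq)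
  signScale-cases Sign.- Sign.- a b eq =
    inj₁ (refl , trans (sym (negV-involutive a)) (trans (cong (negV F) eq) (negV-involutive b)))
  signScale-cases Sign.+ Sign.- a b eq = inj₂ eq
  signScale-cases Sign.- Sign.+ a b eq = inj₂ (trans (sym (negV-involutive a)) (cong (negV F) eq))

  O-fin-base : ∀ k → O F (fin k) (orbitPoint k 0# 1#)
  O-fin-base k = 0# , 1# , (1≢0 , 1# , sym (*-identityʳ 1#)) , refl

  O-fin-third : ∀ {k v} → O F (fin k) v → NonzeroSquare F (third v)
  O-fin-third (_ , _ , sq , refl) = sq

  O-third-nonzero⇒fin : ∀ {i v} → O F i v → ¬ third v ≡ 0# → ∃[ k ] i ≡ fin k
  O-third-nonzero⇒fin {fin k} _ _ = k , refl
  O-third-nonzero⇒fin {∞} (_ , _ , _ , refl) z≢0 = ⊥-elim (z≢0 refl)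
  O-third-nonzero⇒fin {•} (_ , _ , refl) z≢0 = ⊥-elim (z≢0 refl)

  O-fin-unique : ∀ {k i v} → O F (fin k) v → O F i v → i ≡ fin k
  O-fin-unique {k} Ov Ov' with O-third-nonzero⇒fin Ov' (proj₁ (O-fin-third Ov))
  ... | k' , refl with Ov | Ov'
  ...   | x , s , (s≢0 , _) , refl | x' , s' , _ , eq = cong fin (sym k≡k')
    where
      s≡s' : s ≡ s'
      s≡s' = cong third eq
      x≡x' : x ≡ x'
      x≡x' = *-almostCancelˡ s x x' s≢0 (trans (cong (proj₁ ∘ proj₂) eq) (cong (_* x') (sym s≡s')))
      k≡k' : k ≡ k'
      k≡k' = +-cancelˡ (x * x * two F ⁻¹) k k' (*-almostCancelˡ s _ _ s≢0
        (trans (cong proj₁ eq) (cong₂ (λ a b → a * (b * b * two F ⁻¹ + k')) (sym s≡s') (sym x≡x'))))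

  O-fin-not-opposite : IsNonsquare (- 1#) → ∀ {k i w} → O F (fin k) (negV F w) → ¬ O F i w
  O-fin-not-opposite nonsq O-w Ow
    with O-third-nonzero⇒fin Ow (λ eq → proj₁ (O-fin-third O-w) (trans (cong -_ eq) -0#≈0#))
  ... | _ , refl = -1-nonsquare⇒¬nonzeroSquare-neg nonsq (O-fin-third Ow) (O-fin-third O-w)

  signed-O-fin-unique : IsNonsquare (- 1#) → ∀ {k i e e' a b} → O F (fin k) a → O F i b →
    signScale F e a ≡ signScale F e' b → i ≡ fin k × e ≡ e'
  signed-O-fin-unique nonsq {e = e} {e'} {a} {b} Oa Ob eq with signScale-cases e e' a b eq
  ... | inj₁ (e≡e' , refl) = O-fin-unique Oa Ob , e≡e'
  ... | inj₂ refl = ⊥-elim (O-fin-not-opposite nonsq Oa Ob)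

  signed-orbit-not-negV-closed : ∀ ε → (∀ v → InD F ε v → InD F ε (negV F v) → ⊥) →
    ∀ i v → O F i v → ¬ O F i (negV F v)
  signed-orbit-not-negV-closed ε disjoint i v Ov O-v with ε i in εi
  ... | Sign.+ = disjoint v (i , v , Ov , cong (λ e → signScale F e v) (sym εi))
                           (i , negV F v , O-v , cong (λ e → signScale F e (negV F v)) (sym εi))
  ... | Sign.- = disjoint (negV F v) (i , v , Ov , cong (λ e → signScale F e v) (sym εi))
                                     (i , negV F v , O-v , cong (λ e → signScale F e (negV F v)) (sym εi))

  skew⇒-1-nonsquare : ∀ ε D? → IsSkewHadamardDS F (InD F ε) D? → IsNonsquare (- 1#)
  skew⇒-1-nonsquare ε D? (_ , _ , _ , disjoint) (t , -1≡tt) =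
    signed-orbit-not-negV-closed ε disjoint (fin 0#) (orbitPoint 0# 0# 1#)
      (O-fin-base 0#)
      (0# , - 1# , (-1≢0 , t , -1≡tt) ,
       cong₂ _,_ (-‿distribˡ-* 1# _) (cong₂ _,_ (-‿distribˡ-* 1# 0#) refl))
    where
      -1≢0 : ¬ - 1# ≡ 0#
      -1≢0 eq = 1≢0 (trans (sym (-‿involutive 1#)) (trans (cong -_ eq) -0#≈0#))

  hatOnV : Carrier → Aut F → V F → V F
  hatOnV α f = hat F α ∘ onV F f

  shiftIdx : Aut F → Carrier → Idx F → Idx F
  shiftIdx f α (fin i) = fin (Aut.fun f i + α)
  shiftIdx f α ∞ = ∞
  shiftIdx f α • = •

  hat-orbitPoint : ∀ α k x s → hat F α (orbitPoint k x s) ≡ orbitPoint (k + α) x s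
  hat-orbitPoint α k x s = cong (λ a → (a , s * x , s)) (begin
    s * (K + k) + α * s ≡⟨ cong (s * (K + k) +_) (*-comm α s) ⟩
    s * (K + k) + s * α ≡⟨ sym (distribˡ s (K + k) α) ⟩
    s * ((K + k) + α)   ≡⟨ cong (s *_) (+-assoc K k α) ⟩
    s * (K + (k + α))   ∎)
    where K = x * x * two F ⁻¹

  onV-orbitPoint : ¬ two F ≡ 0# → ∀ f k x s →
    onV F f (orbitPoint k x s) ≡ orbitPoint (Aut.fun f k) (Aut.fun f x) (Aut.fun f s)
  onV-orbitPoint 2≢0 f k x s = cong₂ _,_ first (cong (_, fun s) (hom-* s x))
    where
      open Aut f
      open AutProperties f
      first : fun (s * (x * x * two F ⁻¹ + k)) ≡ fun s * (fun x * fun x * two F ⁻¹ + fun k)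
      first = begin
        fun (s * (x * x * two F ⁻¹ + k))            ≡⟨ hom-* s _ ⟩
        fun s * fun (x * x * two F ⁻¹ + k)          ≡⟨ cong (fun s *_) (hom-+ _ k) ⟩
        fun s * (fun (x * x * two F ⁻¹) + fun k)    ≡⟨ cong (λ a → fun s * (a + fun k)) (hom-* (x * x) _) ⟩
        fun s * (fun (x * x) * fun (two F ⁻¹) + fun k)
          ≡⟨ cong₂ (λ a b → fun s * (a * b + fun k)) (hom-* x x) (fun-two⁻¹ 2≢0) ⟩
        fun s * (fun x * fun x * two F ⁻¹ + fun k)  ∎

  hatOnV-O : ¬ two F ≡ 0# → ∀ α f i {u} → O F i u → O F (shiftIdx f α i) (hatOnV α f u)
  hatOnV-O 2≢0 α f (fin k) (x , s , sq , refl) =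
    fun x , fun s , fun-nonzeroSquare sq ,
    trans (cong (hat F α) (onV-orbitPoint 2≢0 f k x s)) (hat-orbitPoint α (fun k) (fun x) (fun s))
    where
      open Aut f
      open AutProperties f
  hatOnV-O 2≢0 α f ∞ (x , s , sq , refl) =
    fun x + α * fun 0# , fun s , fun-nonzeroSquare sq , cong (λ z → (fun x + α * fun 0# , fun s , z)) fun-0
    where
      open Aut f
      open AutProperties f
  hatOnV-O 2≢0 α f • (s , sq , refl) =
    fun s , fun-nonzeroSquare sq , cong₂ _,_ first (cong₂ _,_ fun-0 fun-0)
    where
      open Aut f
      open AutProperties f
      first : fun s + α * fun 0# ≡ fun s
      first = trans (cong (λ z → fun s + α * z) fun-0) (trans (cong (fun s +_) (zeroʳ α)) (+-identityʳ (fun s)))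

  hatOnV-negV : ∀ α f w → hatOnV α f (negV F w) ≡ negV F (hatOnV α f w)
  hatOnV-negV α f (a , b , c) = cong₂ _,_ first (cong₂ _,_ (fun-neg b) (fun-neg c))
    where
      open Aut f
      open AutProperties f
      first : fun (- a) + α * fun (- c) ≡ - (fun a + α * fun c)
      first = begin
        fun (- a) + α * fun (- c) ≡⟨ cong₂ (λ x y → x + α * y) (fun-neg a) (fun-neg c) ⟩
        - fun a + α * - fun c     ≡⟨ cong (- fun a +_) (sym (-‿distribʳ-* α (fun c))) ⟩
        - fun a + - (α * fun c)   ≡⟨ -‿+-comm (fun a) (α * fun c) ⟩
        - (fun a + α * fun c)     ∎

  hatOnV-signScale : ∀ α f e w → hatOnV α f (signScale F e w) ≡ signScale F e (hatOnV α f w)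
  hatOnV-signScale α f Sign.+ w = refl
  hatOnV-signScale α f Sign.- w = hatOnV-negV α f w

  hatOnV-inverse : ∀ α f v → hatOnV α f (hatOnV (Aut.inv f (- α)) (inverseAut f) v) ≡ v
  hatOnV-inverse α f (x , y , z) = cong₂ _,_ first (cong₂ _,_ (inv-r y) (inv-r z))
    where
      open Aut f
      first : fun (inv x + inv (- α) * inv z) + α * fun (inv z) ≡ x
      first = begin
        fun (inv x + inv (- α) * inv z) + α * fun (inv z)
          ≡⟨ cong₂ _+_ (trans (hom-+ _ _) (cong₂ _+_ (inv-r x) (trans (hom-* _ _) (cong₂ _*_ (inv-r (- α)) (inv-r z)))))
                       (cong (α *_) (inv-r z)) ⟩
        (x + - α * z) + α * z   ≡⟨ cong (λ w → (x + w) + α * z) (sym (-‿distribˡ-* α z)) ⟩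
        (x + - (α * z)) + α * z ≡⟨ +-neg-cancelʳ x (α * z) ⟩
        x                       ∎

  record SignInvariant (ε : Idx F → Sign) (f : Aut F) (α : Carrier) : Set where
    constructor sign-invariant
    field at : ∀ k → ε (fin k) ≡ ε (fin (Aut.fun f k + α))

  sign-invariant-shiftIdx : ∀ {ε f α} → SignInvariant ε f α → ∀ i → ε i ≡ ε (shiftIdx f α i)
  sign-invariant-shiftIdx invariant (fin k) = SignInvariant.at invariant k
  sign-invariant-shiftIdx invariant ∞ = refl
  sign-invariant-shiftIdx invariant • = refl

  sign-invariant-inverse : ∀ {ε f α} → SignInvariant ε f α → SignInvariant ε (inverseAut f) (Aut.inv f (- α))
  sign-invariant-inverse {ε} {f} {α} (sign-invariant invariant) = sign-invariant λ k →
    sym (trans (invariant (inv k + inv (- α))) (cong (ε ∘ fin) (fun-inv-shift α k)))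
    where
      open Aut f
      open AutProperties f

  hatOnV-InD : ¬ two F ≡ 0# → ∀ {ε f α} → SignInvariant ε f α → ∀ {w} → InD F ε w → InD F ε (hatOnV α f w)
  hatOnV-InD 2≢0 {ε} {f} {α} invariant (i , u , Ou , refl) =
    shiftIdx f α i , hatOnV α f u , hatOnV-O 2≢0 α f i Ou ,
    trans (hatOnV-signScale α f (ε i) u)
          (cong (λ e → signScale F e (hatOnV α f u)) (sign-invariant-shiftIdx invariant i))

  sign-invariant⇒stabilizes : ¬ two F ≡ 0# → ∀ {ε f α} → SignInvariant ε f α →
    Stabilizes F (hatOnV α f) (InD F ε)
  sign-invariant⇒stabilizes 2≢0 {f = f} {α} invariant v = mk⇔
    (λ { (w , Dw , refl) → hatOnV-InD 2≢0 invariant Dw })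
    (λ Dv → _ , hatOnV-InD 2≢0 (sign-invariant-inverse invariant) Dv , hatOnV-inverse α f v)

  -- Of the signed orbits only ε(k)·O_{f(k)+α} contains the image of ε(k)·(k, 0, 1).
  image-in-D⇒sign-invariant : IsNonsquare (- 1#) → ∀ {ε f α} k →
    InD F ε (hatOnV α f (signScale F (ε (fin k)) (orbitPoint k 0# 1#))) →
    ε (fin k) ≡ ε (fin (Aut.fun f k + α))
  image-in-D⇒sign-invariant nonsq {ε} {f} {α} k (i , w , Ow , eq)
    with signed-O-fin-unique nonsq O-image Ow (trans (sym (hatOnV-signScale α f (ε (fin k)) _)) eq)
    where
      O-image : O F (fin (Aut.fun f k + α)) (hatOnV α f (orbitPoint k 0# 1#))
      O-image = hatOnV-O (-1-nonsquare⇒two≢0 nonsq) α f (fin k) (O-fin-base k)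
  ... | refl , εk≡εi = εk≡εi

  stabilizes⇒sign-invariant : IsNonsquare (- 1#) → ∀ {ε f α} → Stabilizes F (hatOnV α f) (InD F ε) →
    SignInvariant ε f α
  stabilizes⇒sign-invariant nonsq {ε} {f} {α} stab = sign-invariant λ k →
    image-in-D⇒sign-invariant nonsq {ε} {f} {α} k
      (Equivalence.to (stab _) (_ , (fin k , _ , O-fin-base k , refl) , refl))

  sign-invariant⇒shiftedImage : ∀ {ε f α} → SignInvariant ε f α → ShiftedImageEq F f α (InJ F ε)
  sign-invariant⇒shiftedImage {ε} {f} {α} (sign-invariant invariant) y = mk⇔
    (λ { (j , εj , refl) → trans (sym (invariant j)) εj })
    (λ εy → inv y + inv (- α) ,
            trans (invariant _) (trans (cong (ε ∘ fin) (fun-inv-shift α y)) εy) ,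
            sym (fun-inv-shift α y))
    where
      open Aut f
      open AutProperties f

  shiftedImage⇒sign-invariant : ∀ {ε f α} → ShiftedImageEq F f α (InJ F ε) → SignInvariant ε f α
  shiftedImage⇒sign-invariant {ε} {f} {α} shifted = sign-invariant invariant
    where
      invariant : ∀ k → ε (fin k) ≡ ε (fin (Aut.fun f k + α))
      invariant k with ε (fin k) in εk | ε (fin (Aut.fun f k + α)) in εk'
      ... | Sign.+ | Sign.+ = refl
      ... | Sign.- | Sign.- = refl
      ... | Sign.+ | Sign.- = case trans (sym εk') (Equivalence.to (shifted _) (k , εk , refl)) of λ ()
      ... | Sign.- | Sign.+ with Equivalence.from (shifted _) εk'
      ...   | j , εj , eq = case trans (sym εk) (trans (cong (ε ∘ fin) k≡j) εj) of λ ()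
        where
          k≡j : k ≡ j
          k≡j = AutProperties.fun-injective f (+-cancelʳ α _ _ eq)

  stabilizes⇔shiftedImage : IsNonsquare (- 1#) → ∀ {ε f α} →
    Stabilizes F (hatOnV α f) (InD F ε) ⇔ ShiftedImageEq F f α (InJ F ε)
  stabilizes⇔shiftedImage nonsq {ε} {f} {α} = mk⇔
    (sign-invariant⇒shiftedImage ∘ stabilizes⇒sign-invariant nonsq {ε} {f} {α})
    (sign-invariant⇒stabilizes (-1-nonsquare⇒two≢0 nonsq) ∘ shiftedImage⇒sign-invariant {ε} {f} {α})

  Stabilizes-resp-≗ : ∀ {g h D} → g ≗ h → Stabilizes F g D → Stabilizes F h D
  Stabilizes-resp-≗ g≗h stab v = mk⇔
    (λ { (w , Dw , hw≡v) → Equivalence.to (stab v) (w , Dw , trans (g≗h w) hw≡v) })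
    (λ Dv → case Equivalence.from (stab v) Dv of λ { (w , Dw , gw≡v) → w , Dw , trans (sym (g≗h w)) gw≡v })

proposition6p3 : (F : FiniteField) → (p n : ℕ) → Prime p → p % 4 ≡ 3 → n % 2 ≡ 1
    → length (FiniteField.elems F) ≡ p ^ n
    → (ε : Idx F → Sign) → (D? : Decidable (InD F ε)) → IsSkewHadamardDS F (InD F ε) D?
    → (g : V F → V F)
    → (InUFp F p g × Stabilizes F g (InD F ε))
      ⇔ (∃[ α ] ∃[ f ] InSylow F p f × ShiftedImageEq F f α (InJ F ε) × g ≗ (hat F α ∘ onV F f))
proposition6p3 F p n _ _ _ _ ε D? skew g = mk⇔
  (λ { ((α , f , sylow , g≗) , stab) →
       α , f , sylow , Equivalence.to (stabilizes⇔ {f = f}) (Stabilizes-resp-≗ F g≗ stab) , g≗ })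
  (λ { (α , f , sylow , shifted , g≗) →
       (α , f , sylow , g≗) , Stabilizes-resp-≗ F (sym ∘ g≗) (Equivalence.from (stabilizes⇔ {f = f}) shifted) })
  where
    stabilizes⇔ : ∀ {f α} → Stabilizes F (hatOnV F α f) (InD F ε) ⇔ ShiftedImageEq F f α (InJ F ε)
    stabilizes⇔ {f} {α} = stabilizes⇔shiftedImage F (skew⇒-1-nonsquare F ε D? skew) {ε} {f} {α}
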